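{- Let $\mathcal A$ be a tagged TA and let $T_1,T_2\in\mathcal L(\mathcal A)$ be trees that are not single-valued. If $T_1\neq T_2$, then $\mathrm{Tag}(T_1)\neq\mathrm{Tag}(T_2)$.
   Context: Tree automata: a TA is $\mathcal A=\langle Q,\Sigma,\Delta,\mathcal R\rangle$ with finite state set $Q$, ranked alphabet $\Sigma$ of binary and constant symbols, root states $\mathcal R\subseteq Q$, and transitions that are internal $q\xrightarrow{f}(q_0,q_1)$ ($f$ binary) or leaf $q\xrightarrow{c}()$ ($c$ constant). It is assumed that no state has leaf transitions with two different constant symbols (if $q\xrightarrow{c}(),q'\xrightarrow{c'}()\in\Delta$ and $c\ne c'$ then $q\ne q'$). A run on a binary tree (ground term over $\Sigma$) labels each node with a state so that each leaf labelled $c$ with state $q$ has $q\xrightarrow{c}()\in\Delta$ and each internal node labelled $f$ with state $q$ and children states $q_0$ (left), $q_1$ (right) has $q\xrightarrow{f}(q_0,q_1)\in\Delta$; accepting if the root state is in $\mathcal R$; $\mathcal L(\mathcal A)$ is the set of trees with an accepting run. A tagged TA is a TA whose binary symbols are of the form $x_k^j$ (qubit index $k$, tag $j$) and in which distinct internal transitions carry distinct binary symbols (it is obtained from a TA over $x_1,\dots,x_n$ by giving each internal transition $q\xrightarrow{x_k}(q_1,q_2)$ its own index $j$, leaf transitions unchanged). For a tree $T$, $\mathrm{Tag}(T)$ is the tree obtained by replacing every constant (leaf) symbol with a fixed special symbol $\square$. A tree is single-valued if it contains only one constant symbol. -}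

module Defs where

open import Data.Nat using (ℕ)
open import Data.Fin using (Fin)
open import Data.Product using (_×_; _,_; Σ-syntax)
open import Data.List using (List; []; _∷_; _++_)
open import Data.List.Membership.Propositional using (_∈_)
open import Relation.Binary.PropositionalEquality using (_≡_)

data Tree (B C : Set) : Set where
  leaf : C → Tree B C
  node : B → Tree B C → Tree B C → Tree B C

-- Internal transition  q --f--> (q0 , q1)  is represented as (q , f , q0 , q1);
-- leaf transition      q --c--> ()         is represented as (q , c).
record TA (n : ℕ) (B C : Set) : Set where
  field
    internal : List (Fin n × B × Fin n × Fin n)
    leafTr   : List (Fin n × C)
    roots    : List (Fin n)
    leafUnique : ∀ {q c c'} → (q , c) ∈ leafTr → (q , c') ∈ leafTr → c ≡ c'
open TA public

data Run {n : ℕ} {B C : Set} (A : TA n B C) : Fin n → Tree B C → Set where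
  runLeaf : ∀ {q c} → (q , c) ∈ leafTr A → Run A q (leaf c)
  runNode : ∀ {q f q0 q1 t0 t1} → (q , f , q0 , q1) ∈ internal A →
            Run A q0 t0 → Run A q1 t1 → Run A q (node f t0 t1)

_∈L_ : ∀ {n B C} → Tree B C → TA n B C → Set
T ∈L A = Σ[ q ∈ _ ] (q ∈ roots A × Run A q T)

-- Binary symbols of tagged TAs: x_k^j is the pair (k , j) (qubit index k, tag j).
Sym : Set
Sym = ℕ × ℕ

IsTagged : ∀ {n C} → TA n Sym C → Set
IsTagged {n} {C} A =
  ∀ {q f q0 q1 q' f' q0' q1'} →
    (q , f , q0 , q1) ∈ internal A → (q' , f' , q0' , q1') ∈ internal A →
    f ≡ f' → (q , f , q0 , q1) ≡ (q' , f' , q0' , q1')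

data Box : Set where
  □ : Box

Tag : ∀ {B C} → Tree B C → Tree B Box
Tag (leaf c)     = leaf □
Tag (node f l r) = node f (Tag l) (Tag r)

leavesOf : ∀ {B C} → Tree B C → List C
leavesOf (leaf c)     = c ∷ []
leavesOf (node f l r) = leavesOf l ++ leavesOf r

SingleValued : ∀ {B C} → Tree B C → Set
SingleValued T = ∀ {c c'} → c ∈ leavesOf T → c' ∈ leavesOf T → c ≡ c'

-- In a tagged TA the binary symbol at a node determines the transition used there, hence
-- the state of the node and of its children; leaf states determine their constant because
-- no state reads two constants. So two runs from the same state on trees with the same
-- tag run on the same tree. A tree that is not single-valued is not a leaf, so the root
-- symbols of T₁ and T₂ already force their accepting runs to start in the same state.
-- For leaves this fails: leaf c and leaf c' have the same tag whatever their root states.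
module Submission where

open import Defs
open import Data.Nat using (ℕ)
open import Data.Fin using (Fin)
open import Data.Product using (_×_; _,_)
open import Data.List.Relation.Unary.Any using (here)
open import Relation.Nullary using (¬_)
open import Relation.Binary.PropositionalEquality using (_≡_; _≢_; refl; cong; cong₂)

node-injective : ∀ {B C} {f f' : B} {l r l' r' : Tree B C} →
  node f l r ≡ node f' l' r' → f ≡ f' × l ≡ l' × r ≡ r'
node-injective refl = refl , refl , refl

leaf-singleValued : ∀ {B C} (c : C) → SingleValued {B} (leaf c)
leaf-singleValued c (here refl) (here refl) = refl

module _ {n : ℕ} {C : Set} {A : TA n Sym C} (tagged : IsTagged A) where

  Run-node-state-unique : ∀ {q q' f l r l' r'} →
    Run A q (node f l r) → Run A q' (node f l' r') → q ≡ q'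
  Run-node-state-unique (runNode p _ _) (runNode p' _ _) with tagged p p' refl
  ... | refl = refl

  Run-Tag-injective : ∀ {q T₁ T₂} → Run A q T₁ → Run A q T₂ → Tag T₁ ≡ Tag T₂ → T₁ ≡ T₂
  Run-Tag-injective (runLeaf p) (runLeaf p') _ = cong leaf (leafUnique A p p')
  Run-Tag-injective (runNode p l₁ r₁) (runNode p' l₂ r₂) e with node-injective e
  ... | refl , el , er with tagged p p' refl
  ... | refl = cong₂ (node _) (Run-Tag-injective l₁ l₂ el) (Run-Tag-injective r₁ r₂ er)

lemma6p3 : ∀ {n m : ℕ} (A : TA n Sym (Fin m)) → IsTagged A →
    (T₁ T₂ : Tree Sym (Fin m)) → T₁ ∈L A → T₂ ∈L A →
    ¬ SingleValued T₁ → ¬ SingleValued T₂ →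
    T₁ ≢ T₂ → Tag T₁ ≢ Tag T₂
lemma6p3 A tagged (leaf c) _ _ _ ¬sv₁ _ _ _ = ¬sv₁ (leaf-singleValued {Sym} c)
lemma6p3 A tagged _ (leaf c) _ _ _ ¬sv₂ _ _ = ¬sv₂ (leaf-singleValued {Sym} c)
lemma6p3 A tagged (node _ _ _) (node _ _ _) (_ , _ , run₁) (_ , _ , run₂) _ _ T₁≢T₂ e
  with node-injective e
... | refl , _ , _ with Run-node-state-unique tagged run₁ run₂
... | refl = T₁≢T₂ (Run-Tag-injective tagged run₁ run₂ e)
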